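{- Let $a,b$ be positive integers with $\gcd(a,b)=1$ and let $\pi\in\mathcal{D}_{b,-a}(a,b)$. Define the word $z=z_0z_1z_2\cdots$ by $z_0=\mathrm{E}$ and, for $i>0$, $z_i=\mathrm{N}$ if $i\in\Delta^c(\pi)$ and $z_i=\mathrm{E}$ otherwise (so $z_i=\mathrm{E}$ for all $i>ab-a-b$), and let $\tilde f(\pi)$ be the partition whose parts are, for each letter $z_i=\mathrm{N}$, the number of letters $\mathrm{E}$ among $z_0,\dots,z_{i-1}$. Then $\tilde f(\pi)=f(\pi)$.
   Context: A partition with at most $a$ parts and largest part at most $b$ is identified with the set of unit squares of the rectangle $[0,b]\times[0,a]$ lying northwest of a lattice path from $(0,0)$ to $(b,a)$ with unit north and east steps (its path). The level of a lattice point $(x,y)$ is $by-ax$; a unit lattice square has the level of its southeast corner. $\mathcal{D}_{b,-a}(a,b)$ is the set of such partitions whose path visits only lattice points of level $\ge0$. For such $\pi$, $\Delta^c(\pi)$ is the set of levels of the unit squares of the rectangle lying southeast of the path of $\pi$ and above the line $by=ax$ (equivalently, having positive level); these are distinct positive integers. The hook length of a cell $c$ of a partition diagram is the number of cells consisting of $c$, the cells below it in its column and the cells right of it in its row. $f(\pi)$ denotes the unique partition whose first-column hook lengths are exactly the elements of $\Delta^c(\pi)$. -}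

module Defs where

open import Data.Nat using (ℕ; zero; suc; _+_; _*_; _∸_; _≤_; _<_; _<?_; _≟_)
open import Data.Nat.GCD using (gcd)
open import Data.Bool using (Bool; true; false; not)
open import Data.List using (List; []; _∷_; length; filter; map; concatMap; upTo; reverse; applyUpTo)
open import Data.List.Relation.Unary.All using (All)
open import Data.List.Relation.Unary.Linked using (Linked)
open import Data.List.Membership.Propositional using (_∈_)
open import Data.List.Membership.DecPropositional _≟_ using (_∈?_)
open import Data.Fin using (Fin; zero; suc; toℕ)
open import Data.Product using (_×_; Σ; ∃; ∃-syntax)
open import Relation.Nullary.Decidable using (⌊_⌋)
open import Relation.Binary.PropositionalEquality using (_≡_)
open import Function.Bundles using (_⇔_)

data Step : Set where
  N E : Step

countN : List Step → ℕ
countN []      = 0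
countN (N ∷ w) = suc (countN w)
countN (E ∷ w) = countN w

countE : List Step → ℕ
countE []      = 0
countE (N ∷ w) = countE w
countE (E ∷ w) = suc (countE w)

visitsFrom : ℕ → ℕ → List Step → List (ℕ × ℕ)
visitsFrom x y []      = (x Data.Product., y) ∷ []
visitsFrom x y (N ∷ w) = (x Data.Product., y) ∷ visitsFrom x (suc y) w
visitsFrom x y (E ∷ w) = (x Data.Product., y) ∷ visitsFrom (suc x) y w

visits : List Step → List (ℕ × ℕ)
visits = visitsFrom 0 0

-- the level b*y - a*x of (x , y) is ≥ 0
LevelNonNeg : ℕ → ℕ → ℕ × ℕ → Set
LevelNonNeg a b (x Data.Product., y) = a * x ≤ b * y

-- π ∈ D_{b,-a}(a,b), π given by its path from (0,0) to (b,a)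
InD : ℕ → ℕ → List Step → Set
InD a b w = countN w ≡ a × countE w ≡ b × All (LevelNonNeg a b) (visits w)

-- heights of the successive East steps: the i-th East step goes
-- from (i , h_i) to (i+1 , h_i)
eHeightsFrom : ℕ → List Step → List ℕ
eHeightsFrom h []      = []
eHeightsFrom h (N ∷ w) = eHeightsFrom (suc h) w
eHeightsFrom h (E ∷ w) = h ∷ eHeightsFrom h w

-- Δ^c(π): the unit square with lower-left corner (i , j) lies southeast of
-- the path iff j < h_i; its level is that of its SE corner (i+1 , j),
-- namely b*j - a*(i+1); we keep those of positive level.
levelsCol : ℕ → ℕ → ℕ → ℕ → List ℕ
levelsCol a b i h =
  concatMap (λ j → if ⌊ a * suc i <? b * j ⌋ then (b * j ∸ a * suc i) ∷ [] else [])
            (upTo h)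
  where open import Data.Bool using (if_then_else_)

levelsFrom : ℕ → ℕ → ℕ → List ℕ → List ℕ
levelsFrom a b i []       = []
levelsFrom a b i (h ∷ hs) = levelsCol a b i h Data.List.++ levelsFrom a b (suc i) hs

DeltaC : ℕ → ℕ → List Step → List ℕ
DeltaC a b w = levelsFrom a b 0 (eHeightsFrom 0 w)

-- membership in Δ^c(π) is what matters (a set of positive integers)

-- z i ≡ true means z_i = N, false means z_i = E
z : ℕ → ℕ → List Step → ℕ → Bool
z a b w zero    = false
z a b w (suc i) = ⌊ suc i ∈? DeltaC a b w ⌋

numE : ℕ → ℕ → List Step → ℕ → ℕ
numE a b w i = length (filter (λ k → Relation.Nullary.Decidable.¬? (Data.Bool._≟_ (z a b w k) true)) (upTo i))

-- all levels are < a*b, so z_i = E for i ≥ a*b; the letters N occur among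
-- z_0 … z_{a*b}.  Parts listed in weakly decreasing order.
ftilde : ℕ → ℕ → List Step → List ℕ
ftilde a b w =
  reverse (map (numE a b w)
               (filter (λ i → Data.Bool._≟_ (z a b w i) true) (upTo (suc (a * b)))))

IsPartition : List ℕ → Set
IsPartition λs = Linked (λ x y → y ≤ x) λs × All (λ x → 0 < x) λs

countAbove : ℕ → List ℕ → ℕ
countAbove j xs = length (filter (λ r → j <? r) xs)

-- hook length of the cell in row i (0-based), column j (0-based):
-- arm + leg + 1 = (λ_i - j - 1) + #{rows below with part > j} + 1
hookLength : (λs : List ℕ) → Fin (length λs) → ℕ → ℕ
hookLength (x ∷ xs) zero    j = (x ∸ j) + countAbove j xs
hookLength (x ∷ xs) (suc i) j = hookLength xs i j

FirstColHook : List ℕ → ℕ → Set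
FirstColHook λs h = ∃[ i ] hookLength λs i 0 ≡ h

-- λs is a partition whose first-column hook lengths are exactly Δ^c(π),
-- i.e. λs = f(π)
IsF : ℕ → ℕ → List Step → List ℕ → Set
IsF a b w λs = IsPartition λs × (∀ h → FirstColHook λs h ⇔ h ∈ DeltaC a b w)

module Submission where

-- A partition λ₀ ≥ λ₁ ≥ … ≥ λ_{ℓ-1} > 0 has first-column hook lengths
-- λᵢ + (ℓ - 1 - i), a strictly decreasing list from which λ is recovered;
-- hence a partition is determined by the SET of its first-column hooks.
--
-- Read a word z₀ z₁ z₂ … in the letters N/E (z₀ = E) up to position M and
-- let f̃ have one part per letter N, namely the number e of E's before it.
-- For the N at position h, the rows below its row are the N's before it,
-- and e + (number of N's before position h) = h.  So the first-column hooks
-- of f̃ are exactly the positions 1 ≤ h ≤ M of the letters N.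

open import Defs
open import Data.Nat using (ℕ; zero; suc; _+_; _*_; _∸_; _≤_; _<_; _<?_; z≤n; s≤s)
open import Data.Nat.Properties
open import Data.Nat.GCD using (gcd)
open import Data.Bool using (Bool; true; false; if_then_else_)
open import Data.Bool.Properties using (T-≡)
open import Data.List using (List; []; _∷_; _++_; length; filter; map; reverse; upTo)
open import Data.List.Properties using (∷-injective; upTo-∷ʳ; length-++; map-++; reverse-++; filter-all; filter-++)
open import Data.List.Relation.Unary.All using (All; []; _∷_) renaming (lookup to All-lookup; map to All-map)
open import Data.List.Relation.Unary.All.Properties using (++⁺; concat⁺; map⁺; applyUpTo⁺₁)
open import Data.List.Relation.Unary.AllPairs using (AllPairs; []; _∷_)
open import Data.List.Relation.Unary.Any using (here; there)
open import Data.List.Relation.Unary.Linked using (Linked; []; [-]; _∷_)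
open import Data.List.Relation.Unary.Linked.Properties using (Linked⇒AllPairs)
open import Data.List.Membership.Propositional using (_∈_)
open import Data.List.Membership.DecPropositional Data.Nat._≟_ using (_∈?_)
open import Data.Fin using (zero; suc)
open import Data.Product using (_×_; _,_; proj₁; proj₂)
open import Relation.Nullary using (yes; no; ¬_; Dec)
open import Relation.Nullary.Decidable using (⌊_⌋; ¬?; toWitness; fromWitness)
open import Relation.Binary.PropositionalEquality
open import Function.Bundles using (_⇔_; mk⇔; Equivalence)
open import Data.Empty using (⊥-elim)

hookSeq : List ℕ → List ℕ
hookSeq []       = []
hookSeq (x ∷ xs) = (x + length xs) ∷ hookSeq xs

-- Row i's first-column hook is its part plus the number of rows below it,
-- since every row below has a cell in column 0.
firstColHook⇔hookSeq : ∀ λs → All (0 <_) λs → ∀ h → FirstColHook λs h ⇔ h ∈ hookSeq λs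
firstColHook⇔hookSeq λs pos h = mk⇔ (to λs pos) (from λs pos)
  where
  rowsBelow : ∀ {xs} → All (0 <_) xs → countAbove 0 xs ≡ length xs
  rowsBelow pxs = cong length (filter-all (0 <?_) pxs)

  to : ∀ λs → All (0 <_) λs → FirstColHook λs h → h ∈ hookSeq λs
  to (x ∷ xs) (_ ∷ pxs) (zero , eq)  = here (trans (sym eq) (cong (x +_) (rowsBelow pxs)))
  to (x ∷ xs) (_ ∷ pxs) (suc i , eq) = there (to xs pxs (i , eq))

  from : ∀ λs → All (0 <_) λs → h ∈ hookSeq λs → FirstColHook λs h
  from (x ∷ xs) (_ ∷ pxs) (here refl) = zero , cong (x +_) (rowsBelow pxs)
  from (x ∷ xs) (_ ∷ pxs) (there m)   with i , eq ← from xs pxs m = suc i , eq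

-- The parts can be read back off the hooks: subtract the number of rows below.
hookSeq-injective : ∀ xs ys → hookSeq xs ≡ hookSeq ys → xs ≡ ys
hookSeq-injective []       []       _ = refl
hookSeq-injective (x ∷ xs) (y ∷ ys) eq
  with headEq , tailEq ← ∷-injective eq
  with refl ← hookSeq-injective xs ys tailEq
  = cong (_∷ xs) (+-cancelʳ-≡ (length xs) x y headEq)

StrictlyDecreasing : List ℕ → Set
StrictlyDecreasing = AllPairs (λ u v → v < u)

hookSeq-strictlyDecreasing : ∀ λs → Linked (λ u v → v ≤ u) λs → StrictlyDecreasing (hookSeq λs)
hookSeq-strictlyDecreasing λs dec = Linked⇒AllPairs (λ q r → <-trans r q) (linked λs dec)
  where
  linked : ∀ λs → Linked (λ u v → v ≤ u) λs → Linked (λ u v → v < u) (hookSeq λs)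
  linked []           _        = []
  linked (x ∷ [])     _        = [-]
  linked (x ∷ y ∷ ys) (y≤x ∷ l) =
    ≤-trans (s≤s (+-monoˡ-≤ (length ys) y≤x)) (≤-reflexive (sym (+-suc x (length ys))))
    ∷ linked (y ∷ ys) l

≤head : ∀ {h u us} → h ∈ u ∷ us → All (_< u) us → h ≤ u
≤head (here refl) _  = ≤-refl
≤head (there m)   us = <⇒≤ (All-lookup us m)

∈tail : ∀ {h u us} → h < u → h ∈ u ∷ us → h ∈ us
∈tail h<u (here refl) = ⊥-elim (<-irrefl refl h<u)
∈tail _   (there m)   = m

strictlyDecreasing-ext : ∀ xs ys → StrictlyDecreasing xs → StrictlyDecreasing ys →
  (∀ h → h ∈ xs → h ∈ ys) → (∀ h → h ∈ ys → h ∈ xs) → xs ≡ ys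
strictlyDecreasing-ext [] [] _ _ _ _ = refl
strictlyDecreasing-ext [] (y ∷ ys) _ _ _ ys⊆xs with () ← ys⊆xs y (here refl)
strictlyDecreasing-ext (x ∷ xs) [] _ _ xs⊆ys _ with () ← xs⊆ys x (here refl)
strictlyDecreasing-ext (x ∷ xs) (y ∷ ys) (x> ∷ sx) (y> ∷ sy) xs⊆ys ys⊆xs
  with refl ← ≤-antisym (≤head (xs⊆ys x (here refl)) y>) (≤head (ys⊆xs y (here refl)) x>)
  = cong (x ∷_) (strictlyDecreasing-ext xs ys sx sy
      (λ h m → ∈tail (All-lookup x> m) (xs⊆ys h (there m)))
      (λ h m → ∈tail (All-lookup y> m) (ys⊆xs h (there m))))

partition-determinedByHooks : ∀ λs μs → IsPartition λs → IsPartition μs →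
  (∀ h → FirstColHook λs h ⇔ FirstColHook μs h) → λs ≡ μs
partition-determinedByHooks λs μs (decλ , posλ) (decμ , posμ) same =
  hookSeq-injective λs μs
    (strictlyDecreasing-ext (hookSeq λs) (hookSeq μs)
      (hookSeq-strictlyDecreasing λs decλ) (hookSeq-strictlyDecreasing μs decμ)
      (λ h m → hookλ⇒μ h (Equivalence.from (firstColHook⇔hookSeq λs posλ h) m))
      (λ h m → hookμ⇒λ h (Equivalence.from (firstColHook⇔hookSeq μs posμ h) m)))
  where
  hookλ⇒μ : ∀ h → FirstColHook λs h → h ∈ hookSeq μs
  hookλ⇒μ h fc = Equivalence.to (firstColHook⇔hookSeq μs posμ h) (Equivalence.to (same h) fc)
  hookμ⇒λ : ∀ h → FirstColHook μs h → h ∈ hookSeq λs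
  hookμ⇒λ h fc = Equivalence.to (firstColHook⇔hookSeq λs posλ h) (Equivalence.from (same h) fc)

prependIf : Bool → ℕ → List ℕ → List ℕ
prependIf true  x l = x ∷ l
prependIf false x l = l

∈-prependIf : ∀ c y {x l} → x ∈ l → x ∈ prependIf c y l
∈-prependIf true  y m = there m
∈-prependIf false y m = m

filter-upTo-suc : ∀ {P : ℕ → Set} (P? : (x : ℕ) → Dec (P x)) n →
  filter P? (upTo (suc n)) ≡ filter P? (upTo n) ++ filter P? (n ∷ [])
filter-upTo-suc P? n = trans (cong (filter P?) (sym (upTo-∷ʳ n))) (filter-++ P? (upTo n) (n ∷ []))

module WordPartition (isN : ℕ → Bool) (startsWithE : isN 0 ≡ false) where

  N? : (k : ℕ) → Dec (isN k ≡ true)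
  N? k = isN k Data.Bool.≟ true

  E? : (k : ℕ) → Dec (¬ isN k ≡ true)
  E? k = ¬? (N? k)

  eCount : ℕ → ℕ
  eCount i = length (filter E? (upTo i))

  ftildeUpTo : ℕ → List ℕ
  ftildeUpTo M = reverse (map eCount (filter N? (upTo (suc M))))

  partsUpTo : ℕ → List ℕ
  partsUpTo zero    = []
  partsUpTo (suc M) = prependIf (isN (suc M)) (eCount (suc M)) (partsUpTo M)

  nPositions : ℕ → List ℕ
  nPositions zero    = []
  nPositions (suc M) = prependIf (isN (suc M)) (suc M) (nPositions M)

  eCount-suc : ∀ n → eCount (suc n) ≡ eCount n + (if isN n then 0 else 1)
  eCount-suc n = begin
    length (filter E? (upTo (suc n)))                      ≡⟨ cong length (filter-upTo-suc E? n) ⟩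
    length (filter E? (upTo n) ++ filter E? (n ∷ []))      ≡⟨ length-++ (filter E? (upTo n)) ⟩
    eCount n + length (filter E? (n ∷ []))                 ≡⟨ cong (eCount n +_) lastLetter ⟩
    eCount n + (if isN n then 0 else 1)                    ∎
    where
    open ≡-Reasoning
    lastLetter : length (filter E? (n ∷ [])) ≡ (if isN n then 0 else 1)
    lastLetter with isN n
    ... | true  = refl
    ... | false = refl

  eCount-mono : ∀ n → eCount n ≤ eCount (suc n)
  eCount-mono n = ≤-trans (m≤m+n (eCount n) _) (≤-reflexive (sym (eCount-suc n)))

  eCount-one : eCount 1 ≡ 1
  eCount-one rewrite startsWithE = refl

  -- because z₀ = E, every part is positive
  eCount-pos : ∀ k → 0 < eCount (suc k)
  eCount-pos zero    rewrite eCount-one = s≤s z≤n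
  eCount-pos (suc k) = ≤-trans (eCount-pos k) (eCount-mono (suc k))

  ftildeUpTo≡partsUpTo : ∀ M → ftildeUpTo M ≡ partsUpTo M
  ftildeUpTo≡partsUpTo zero rewrite startsWithE = refl
  ftildeUpTo≡partsUpTo (suc M) = begin
    reverse (map eCount (filter N? (upTo (suc (suc M)))))
      ≡⟨ cong (λ l → reverse (map eCount l)) (filter-upTo-suc N? (suc M)) ⟩
    reverse (map eCount (earlier ++ last))
      ≡⟨ cong reverse (map-++ eCount earlier last) ⟩
    reverse (map eCount earlier ++ map eCount last)
      ≡⟨ reverse-++ (map eCount earlier) (map eCount last) ⟩
    reverse (map eCount last) ++ ftildeUpTo M
      ≡⟨ cong (reverse (map eCount last) ++_) (ftildeUpTo≡partsUpTo M) ⟩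
    reverse (map eCount last) ++ partsUpTo M
      ≡⟨ lastPart ⟩
    partsUpTo (suc M) ∎
    where
    open ≡-Reasoning
    earlier last : List ℕ
    earlier = filter N? (upTo (suc M))
    last    = filter N? (suc M ∷ [])
    lastPart : reverse (map eCount last) ++ partsUpTo M ≡ partsUpTo (suc M)
    lastPart with isN (suc M)
    ... | true  = refl
    ... | false = refl

  letterCount : ∀ M → eCount (suc M) + length (partsUpTo M) ≡ suc M
  letterCount zero rewrite eCount-one = refl
  letterCount (suc M) rewrite eCount-suc (suc M) with isN (suc M)
  ... | true  = begin
    eCount (suc M) + 0 + suc (length (partsUpTo M))  ≡⟨ cong (_+ suc (length (partsUpTo M))) (+-identityʳ (eCount (suc M))) ⟩
    eCount (suc M) + suc (length (partsUpTo M))      ≡⟨ +-suc (eCount (suc M)) _ ⟩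
    suc (eCount (suc M) + length (partsUpTo M))      ≡⟨ cong suc (letterCount M) ⟩
    suc (suc M)                                      ∎
    where open ≡-Reasoning
  ... | false = begin
    eCount (suc M) + 1 + length (partsUpTo M)        ≡⟨ +-assoc (eCount (suc M)) 1 _ ⟩
    eCount (suc M) + suc (length (partsUpTo M))      ≡⟨ +-suc (eCount (suc M)) _ ⟩
    suc (eCount (suc M) + length (partsUpTo M))      ≡⟨ cong suc (letterCount M) ⟩
    suc (suc M)                                      ∎
    where open ≡-Reasoning

  hookSeq-partsUpTo : ∀ M → hookSeq (partsUpTo M) ≡ nPositions M
  hookSeq-partsUpTo zero = refl
  hookSeq-partsUpTo (suc M) with isN (suc M)
  ... | true  = cong₂ _∷_ (letterCount M) (hookSeq-partsUpTo M)
  ... | false = hookSeq-partsUpTo M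

  ∈nPositions⇔ : ∀ M h → h ∈ nPositions M ⇔ (0 < h × h ≤ M × isN h ≡ true)
  ∈nPositions⇔ M h = mk⇔ (to M) (from M)
    where
    to : ∀ M → h ∈ nPositions M → 0 < h × h ≤ M × isN h ≡ true
    to (suc M) m with isN (suc M) in isN[M+1]
    to (suc M) (here refl) | true = s≤s z≤n , ≤-refl , isN[M+1]
    to (suc M) (there m)   | true  with 0<h , h≤M , isNh ← to M m = 0<h , m≤n⇒m≤1+n h≤M , isNh
    to (suc M) m           | false with 0<h , h≤M , isNh ← to M m = 0<h , m≤n⇒m≤1+n h≤M , isNh

    from : ∀ M → 0 < h × h ≤ M × isN h ≡ true → h ∈ nPositions M
    from zero    (0<h , z≤n , _) with () ← 0<h
    from (suc M) (0<h , h≤M+1 , isNh) with h Data.Nat.≟ suc M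
    ... | yes refl rewrite isNh = here refl
    ... | no h≢M+1 = ∈-prependIf (isN (suc M)) (suc M) (from M (0<h , ≤-pred (≤∧≢⇒< h≤M+1 h≢M+1) , isNh))

  partsUpTo-isPartition : ∀ M → IsPartition (partsUpTo M) × All (_≤ eCount (suc M)) (partsUpTo M)
  partsUpTo-isPartition zero = ([] , []) , []
  partsUpTo-isPartition (suc M) with (dec , pos) , bounded ← partsUpTo-isPartition M | isN (suc M)
  ... | true  = (prepend bounded dec , eCount-pos M ∷ pos) , eCount-mono (suc M) ∷ raise bounded
    where
    prepend : ∀ {x l} → All (_≤ x) l → Linked (λ u v → v ≤ u) l → Linked (λ u v → v ≤ u) (x ∷ l)
    prepend []        []  = [-]
    prepend (y≤x ∷ _) dec = y≤x ∷ dec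
    raise : All (_≤ eCount (suc M)) (partsUpTo M) → All (_≤ eCount (suc (suc M))) (partsUpTo M)
    raise = All-map (λ q → ≤-trans q (eCount-mono (suc M)))
  ... | false = (dec , pos) , All-map (λ q → ≤-trans q (eCount-mono (suc M))) bounded

  ftildeUpTo-hooks : ∀ M h → FirstColHook (ftildeUpTo M) h ⇔ (0 < h × h ≤ M × isN h ≡ true)
  ftildeUpTo-hooks M h rewrite ftildeUpTo≡partsUpTo M =
    mk⇔ (λ fc → Equivalence.to (∈nPositions⇔ M h)
                  (subst (h ∈_) (hookSeq-partsUpTo M) (Equivalence.to hooks fc)))
        (λ nh → Equivalence.from hooks
                  (subst (h ∈_) (sym (hookSeq-partsUpTo M)) (Equivalence.from (∈nPositions⇔ M h) nh)))
    where
    hooks : FirstColHook (partsUpTo M) h ⇔ h ∈ hookSeq (partsUpTo M)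
    hooks = firstColHook⇔hookSeq (partsUpTo M) (proj₂ (proj₁ (partsUpTo-isPartition M))) h

  ftildeUpTo-isPartition : ∀ M → IsPartition (ftildeUpTo M)
  ftildeUpTo-isPartition M rewrite ftildeUpTo≡partsUpTo M = proj₁ (partsUpTo-isPartition M)

InRange : ℕ → ℕ → ℕ → Set
InRange a b x = 0 < x × x ≤ a * b

eHeights-bounded : ∀ h w → All (_≤ h + countN w) (eHeightsFrom h w)
eHeights-bounded h []      = []
eHeights-bounded h (N ∷ w) =
  All-map (λ q → ≤-trans q (≤-reflexive (sym (+-suc h (countN w))))) (eHeights-bounded (suc h) w)
eHeights-bounded h (E ∷ w) = m≤m+n h (countN w) ∷ eHeights-bounded h w

levelsCol-inRange : ∀ a b i h → h ≤ a → All (InRange a b) (levelsCol a b i h)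
levelsCol-inRange a b i h h≤a =
  concat⁺ (map⁺ (applyUpTo⁺₁ _ h (λ j<h → square (≤-trans (<⇒≤ j<h) h≤a))))
  where
  square : ∀ {j} → j ≤ a →
    All (InRange a b) (if ⌊ a * suc i <? b * j ⌋ then (b * j ∸ a * suc i) ∷ [] else [])
  square {j} j≤a with a * suc i <? b * j
  ... | yes lt = (m<n⇒0<n∸m lt , ≤-trans (m∸n≤m (b * j) (a * suc i))
                   (≤-trans (*-monoʳ-≤ b j≤a) (≤-reflexive (*-comm b a)))) ∷ []
  ... | no _   = []

levelsFrom-inRange : ∀ a b i hs → All (_≤ a) hs → All (InRange a b) (levelsFrom a b i hs)
levelsFrom-inRange a b i []       []         = []
levelsFrom-inRange a b i (h ∷ hs) (h≤a ∷ hs≤a) =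
  ++⁺ (levelsCol-inRange a b i h h≤a) (levelsFrom-inRange a b (suc i) hs hs≤a)

-- a path ending at height a has all East steps at height ≤ a
DeltaC-inRange : ∀ a b w → countN w ≡ a → All (InRange a b) (DeltaC a b w)
DeltaC-inRange a b w refl = levelsFrom-inRange a b 0 (eHeightsFrom 0 w) (eHeights-bounded 0 w)

z⇔DeltaC : ∀ a b w k → z a b w (suc k) ≡ true ⇔ suc k ∈ DeltaC a b w
z⇔DeltaC a b w k =
  mk⇔ (λ eq → toWitness (Equivalence.from T-≡ eq)) (λ m → Equivalence.to T-≡ (fromWitness m))

lemma4p9 : (a b : ℕ) → 0 < a → 0 < b → gcd a b ≡ 1 →
           (w : List Step) → InD a b w →
           IsF a b w (ftilde a b w) × ((μ : List ℕ) → IsF a b w μ → μ ≡ ftilde a b w)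
lemma4p9 a b _ _ _ w (countN≡a , _ , _) = isF , unique
  where
  open WordPartition (z a b w) refl

  -- f̃(π) reads z up to a·b, which covers Δ^c(π)
  hooks≡DeltaC : ∀ h → FirstColHook (ftilde a b w) h ⇔ h ∈ DeltaC a b w
  hooks≡DeltaC h = mk⇔ to from
    where
    to : FirstColHook (ftilde a b w) h → h ∈ DeltaC a b w
    to fc with Equivalence.to (ftildeUpTo-hooks (a * b) h) fc
    ... | s≤s _ , _ , zh = Equivalence.to (z⇔DeltaC a b w _) zh
    from : h ∈ DeltaC a b w → FirstColHook (ftilde a b w) h
    from m with All-lookup (DeltaC-inRange a b w countN≡a) m
    ... | 0<h@(s≤s _) , h≤ab =
      Equivalence.from (ftildeUpTo-hooks (a * b) h) (0<h , h≤ab , Equivalence.from (z⇔DeltaC a b w _) m)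

  isF : IsF a b w (ftilde a b w)
  isF = ftildeUpTo-isPartition (a * b) , hooks≡DeltaC

  unique : (μ : List ℕ) → IsF a b w μ → μ ≡ ftilde a b w
  unique μ (μ-partition , μ-hooks) =
    partition-determinedByHooks μ (ftilde a b w) μ-partition (proj₁ isF)
      (λ h → mk⇔ (λ fc → Equivalence.from (hooks≡DeltaC h) (Equivalence.to (μ-hooks h) fc))
                 (λ fc → Equivalence.from (μ-hooks h) (Equivalence.to (hooks≡DeltaC h) fc)))
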